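{- Let $n\ge1$, let $U(\mathbb H(\mathbb Z_{2^n}))$ be the set of units of $\mathbb H(\mathbb Z_{2^n})$, and let $\mathcal U(\mathbb H(\mathbb Z_{2^n}))=U(\mathbb H(\mathbb Z_{2^n}))\setminus\{(1,0,0,0),(2^n-1,0,0,0)\}$. Then every vertex in $\mathcal U(\mathbb H(\mathbb Z_{2^n}))$ is adjacent to every other vertex of $\Phi(\mathbb H(\mathbb Z_{2^n}))$.
   Context: $\mathbb H(\mathbb Z_{2^n})$ is the ring of Hamilton quaternions over $\mathbb Z_{2^n}$. Its elements are $a_1+a_2i+a_3j+a_4k$ with $a_i\in\mathbb Z_{2^n}$, written $(a_1,a_2,a_3,a_4)$. Addition is coordinatewise, and multiplication is determined by distributivity, scalars commuting with $i,j,k$, and $i^2=j^2=k^2=-1$, $ij=-ji=k$, $jk=-kj=i$, $ki=-ik=j$. For a ring $R$ with unity, the non-zero divisor graph $\Phi(R)$ is the simple graph with vertex set $R\setminus\{0,1,-1\}$ in which two distinct vertices $x,y$ are adjacent if and only if $xy\neq0$ or $yx\neq0$. -}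

module Defs where

open import Data.Nat using (ℕ; _+_; _*_; _∸_; _^_; NonZero)
open import Data.Nat.Properties using (m^n≢0)
open import Data.Nat.DivMod using (_mod_)
open import Data.Fin using (Fin; toℕ)
open import Data.Product using (Σ; _×_; _,_)
open import Data.Sum using (_⊎_)
open import Relation.Binary.PropositionalEquality using (_≡_; _≢_)

mod2^ : ℕ → ℕ
mod2^ n = 2 ^ n


ℤ₂^ : ℕ → Set
ℤ₂^ n = Fin (mod2^ n)

module Zmod (n : ℕ) where
  M : ℕ
  M = mod2^ n

  instance
    M-nonZero : NonZero M
    M-nonZero = m^n≢0 2 n

  _⊕_ : ℤ₂^ n → ℤ₂^ n → ℤ₂^ n
  a ⊕ b = (toℕ a + toℕ b) mod M

  _⊗_ : ℤ₂^ n → ℤ₂^ n → ℤ₂^ n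
  a ⊗ b = (toℕ a * toℕ b) mod M

  ⊖_ : ℤ₂^ n → ℤ₂^ n
  ⊖ a = (M ∸ toℕ a) mod M

  _⊝_ : ℤ₂^ n → ℤ₂^ n → ℤ₂^ n
  a ⊝ b = a ⊕ (⊖ b)

  z0 z1 : ℤ₂^ n
  z0 = 0 mod M
  z1 = 1 mod M

  infixl 7 _⊗_
  infixl 6 _⊕_ _⊝_

-- Hamilton quaternions a1 + a2 i + a3 j + a4 k over Z_{2^n}
record ℍ (n : ℕ) : Set where
  constructor quat
  field
    a₁ a₂ a₃ a₄ : ℤ₂^ n

module Quat (n : ℕ) where
  open Zmod n

  0ℍ 1ℍ -1ℍ : ℍ n
  0ℍ  = quat z0 z0 z0 z0
  1ℍ  = quat z1 z0 z0 z0
  -1ℍ = quat (⊖ z1) z0 z0 z0      -- = (2^n - 1, 0, 0, 0)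

  -- Hamilton product (i² = j² = k² = -1, ij = k, jk = i, ki = j)
  _·_ : ℍ n → ℍ n → ℍ n
  quat a1 a2 a3 a4 · quat b1 b2 b3 b4 =
    quat (a1 ⊗ b1 ⊝ a2 ⊗ b2 ⊝ a3 ⊗ b3 ⊝ a4 ⊗ b4)
         (a1 ⊗ b2 ⊕ a2 ⊗ b1 ⊕ a3 ⊗ b4 ⊝ a4 ⊗ b3)
         (a1 ⊗ b3 ⊝ a2 ⊗ b4 ⊕ a3 ⊗ b1 ⊕ a4 ⊗ b2)
         (a1 ⊗ b4 ⊕ a2 ⊗ b3 ⊝ a3 ⊗ b2 ⊕ a4 ⊗ b1)

  IsUnit : ℍ n → Set
  IsUnit x = Σ (ℍ n) λ y → (x · y ≡ 1ℍ) × (y · x ≡ 1ℍ)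

  In𝒰 : ℍ n → Set
  In𝒰 x = IsUnit x × x ≢ 1ℍ × x ≢ -1ℍ

  IsVertex : ℍ n → Set
  IsVertex x = x ≢ 0ℍ × x ≢ 1ℍ × x ≢ -1ℍ

  Adjacent : ℍ n → ℍ n → Set
  Adjacent x y = x ≢ y × ((x · y ≢ 0ℍ) ⊎ (y · x ≢ 0ℍ))

module Submission where

-- Lifting residues to ℤ turns the Hamilton product of ℍ(ℤ/2ⁿ) into that of the
-- integer quaternions up to congruence mod 2ⁿ, and distinct residues are incongruent;
-- so associativity, the left unit and the right zero transfer from ℤ to ℍ(ℤ/2ⁿ).
-- If y·u = 1 and u·v = 0 then v = (y·u)·v = y·(u·v) = 0: a unit u has a nonzero
-- product u·v with every vertex v.

open import Defs
open import Data.Nat as ℕ using (ℕ; suc; _≥_; _<_; NonZero)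
open import Data.Nat.Properties as ℕ
  using (m∸n≤m; m∸n≡0⇒m≤n; m∸n+n≡m; ≤-antisym; ≤-<-trans; ≤-total)
import Data.Nat.Divisibility as ℕ
open import Data.Nat.DivMod using (_mod_; _%_; _/_; m%n<n)
open import Data.Integer.DivMod using (_%ℕ_; _/ℕ_; a≡a%ℕn+[a/ℕn]*n)
open import Data.Integer using (ℤ; +_; _+_; _*_; -_; _-_)
open import Data.Integer.Properties using (pos-+; pos-*; m-n≡m⊖n; ⊖-≥)
open import Data.Integer.Divisibility.Signed
  using (_∣_; ∣-refl; ∣m∣n⇒∣m+n; ∣m⇒∣-m; ∣n⇒∣m*n; ∣m⇒∣m*n; ∣⇒∣ᵤ)
open import Data.Integer.Tactic.RingSolver using (solve-∀)
open import Data.Fin using (toℕ)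
open import Data.Fin.Properties using (toℕ-fromℕ<; toℕ-injective; toℕ<n)
open import Data.Product using (_,_)
open import Data.Sum using (inj₁; inj₂)
open import Data.Empty using (⊥-elim)
open import Algebra.Definitions using (Associative; LeftIdentity; RightZero)
open import Relation.Binary.Bundles using (Setoid)
open import Relation.Binary.Structures using (IsEquivalence)
open import Relation.Binary.PropositionalEquality using (_≡_; _≢_; refl; sym; trans; cong; subst)
import Relation.Binary.Reasoning.Setoid as SetoidReasoning

y∙u≡ε⇒u∙w≡0⇒w≡0 : {A : Set} {_∙_ : A → A → A} {ε 0# : A} →
  Associative _≡_ _∙_ → LeftIdentity _≡_ ε _∙_ → RightZero _≡_ 0# _∙_ →
  ∀ {y u w} → y ∙ u ≡ ε → u ∙ w ≡ 0# → w ≡ 0#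
y∙u≡ε⇒u∙w≡0⇒w≡0 {_∙_ = _∙_} {ε} {0#} assoc identityˡ zeroʳ {y} {u} {w} y∙u≡ε u∙w≡0 =
  begin
  w             ≡⟨ identityˡ w ⟨
  ε ∙ w         ≡⟨ cong (_∙ w) y∙u≡ε ⟨
  (y ∙ u) ∙ w   ≡⟨ assoc y u w ⟩
  y ∙ (u ∙ w)   ≡⟨ cong (y ∙_) u∙w≡0 ⟩
  y ∙ 0#        ≡⟨ zeroʳ y ⟩
  0#            ∎
  where open Relation.Binary.PropositionalEquality.≡-Reasoning

record ℤℍ : Set where
  constructor quatℤ
  field re im₁ im₂ im₃ : ℤ

infixl 7 _·ℤ_
_·ℤ_ : ℤℍ → ℤℍ → ℤℍ
quatℤ a1 a2 a3 a4 ·ℤ quatℤ b1 b2 b3 b4 =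
  quatℤ (a1 * b1 - a2 * b2 - a3 * b3 - a4 * b4)
        (a1 * b2 + a2 * b1 + a3 * b4 - a4 * b3)
        (a1 * b3 - a2 * b4 + a3 * b1 + a4 * b2)
        (a1 * b4 + a2 * b3 - a3 * b2 + a4 * b1)

0ℤℍ 1ℤℍ : ℤℍ
0ℤℍ = quatℤ (+ 0) (+ 0) (+ 0) (+ 0)
1ℤℍ = quatℤ (+ 1) (+ 0) (+ 0) (+ 0)

quatℤ-cong : ∀ {a b c d a′ b′ c′ d′} → a ≡ a′ → b ≡ b′ → c ≡ c′ → d ≡ d′ →
  quatℤ a b c d ≡ quatℤ a′ b′ c′ d′
quatℤ-cong refl refl refl refl = refl

-- The ring solver does not unfold _·ℤ_, so the four component identities are spelled out.
·ℤ-assoc : Associative _≡_ _·ℤ_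
·ℤ-assoc (quatℤ a1 a2 a3 a4) (quatℤ b1 b2 b3 b4) (quatℤ c1 c2 c3 c4) =
  quatℤ-cong (re a1 a2 a3 a4 b1 b2 b3 b4 c1 c2 c3 c4) (im₁ a1 a2 a3 a4 b1 b2 b3 b4 c1 c2 c3 c4)
             (im₂ a1 a2 a3 a4 b1 b2 b3 b4 c1 c2 c3 c4) (im₃ a1 a2 a3 a4 b1 b2 b3 b4 c1 c2 c3 c4)
  where
  re : ∀ a1 a2 a3 a4 b1 b2 b3 b4 c1 c2 c3 c4 →
    (a1 * b1 - a2 * b2 - a3 * b3 - a4 * b4) * c1 - (a1 * b2 + a2 * b1 + a3 * b4 - a4 * b3) * c2
      - (a1 * b3 - a2 * b4 + a3 * b1 + a4 * b2) * c3 - (a1 * b4 + a2 * b3 - a3 * b2 + a4 * b1) * c4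
    ≡ a1 * (b1 * c1 - b2 * c2 - b3 * c3 - b4 * c4) - a2 * (b1 * c2 + b2 * c1 + b3 * c4 - b4 * c3)
      - a3 * (b1 * c3 - b2 * c4 + b3 * c1 + b4 * c2) - a4 * (b1 * c4 + b2 * c3 - b3 * c2 + b4 * c1)
  re = solve-∀
  im₁ : ∀ a1 a2 a3 a4 b1 b2 b3 b4 c1 c2 c3 c4 →
    (a1 * b1 - a2 * b2 - a3 * b3 - a4 * b4) * c2 + (a1 * b2 + a2 * b1 + a3 * b4 - a4 * b3) * c1
      + (a1 * b3 - a2 * b4 + a3 * b1 + a4 * b2) * c4 - (a1 * b4 + a2 * b3 - a3 * b2 + a4 * b1) * c3
    ≡ a1 * (b1 * c2 + b2 * c1 + b3 * c4 - b4 * c3) + a2 * (b1 * c1 - b2 * c2 - b3 * c3 - b4 * c4)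
      + a3 * (b1 * c4 + b2 * c3 - b3 * c2 + b4 * c1) - a4 * (b1 * c3 - b2 * c4 + b3 * c1 + b4 * c2)
  im₁ = solve-∀
  im₂ : ∀ a1 a2 a3 a4 b1 b2 b3 b4 c1 c2 c3 c4 →
    (a1 * b1 - a2 * b2 - a3 * b3 - a4 * b4) * c3 - (a1 * b2 + a2 * b1 + a3 * b4 - a4 * b3) * c4
      + (a1 * b3 - a2 * b4 + a3 * b1 + a4 * b2) * c1 + (a1 * b4 + a2 * b3 - a3 * b2 + a4 * b1) * c2
    ≡ a1 * (b1 * c3 - b2 * c4 + b3 * c1 + b4 * c2) - a2 * (b1 * c4 + b2 * c3 - b3 * c2 + b4 * c1)
      + a3 * (b1 * c1 - b2 * c2 - b3 * c3 - b4 * c4) + a4 * (b1 * c2 + b2 * c1 + b3 * c4 - b4 * c3)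
  im₂ = solve-∀
  im₃ : ∀ a1 a2 a3 a4 b1 b2 b3 b4 c1 c2 c3 c4 →
    (a1 * b1 - a2 * b2 - a3 * b3 - a4 * b4) * c4 + (a1 * b2 + a2 * b1 + a3 * b4 - a4 * b3) * c3
      - (a1 * b3 - a2 * b4 + a3 * b1 + a4 * b2) * c2 + (a1 * b4 + a2 * b3 - a3 * b2 + a4 * b1) * c1
    ≡ a1 * (b1 * c4 + b2 * c3 - b3 * c2 + b4 * c1) + a2 * (b1 * c3 - b2 * c4 + b3 * c1 + b4 * c2)
      - a3 * (b1 * c2 + b2 * c1 + b3 * c4 - b4 * c3) + a4 * (b1 * c1 - b2 * c2 - b3 * c3 - b4 * c4)
  im₃ = solve-∀

·ℤ-identityˡ : LeftIdentity _≡_ 1ℤℍ _·ℤ_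
·ℤ-identityˡ (quatℤ a b c d) = quatℤ-cong (re a b c d) (im₁ a b c d) (im₂ a b c d) (im₃ a b c d)
  where
  re : ∀ a b c d → + 1 * a - + 0 * b - + 0 * c - + 0 * d ≡ a
  re = solve-∀
  im₁ : ∀ a b c d → + 1 * b + + 0 * a + + 0 * d - + 0 * c ≡ b
  im₁ = solve-∀
  im₂ : ∀ a b c d → + 1 * c - + 0 * d + + 0 * a + + 0 * b ≡ c
  im₂ = solve-∀
  im₃ : ∀ a b c d → + 1 * d + + 0 * c - + 0 * b + + 0 * a ≡ d
  im₃ = solve-∀

·ℤ-zeroʳ : RightZero _≡_ 0ℤℍ _·ℤ_
·ℤ-zeroʳ (quatℤ a b c d) = quatℤ-cong (re a b c d) (im₁ a b c d) (im₂ a b c d) (im₃ a b c d)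
  where
  re : ∀ a b c d → a * + 0 - b * + 0 - c * + 0 - d * + 0 ≡ + 0
  re = solve-∀
  im₁ : ∀ a b c d → a * + 0 + b * + 0 + c * + 0 - d * + 0 ≡ + 0
  im₁ = solve-∀
  im₂ : ∀ a b c d → a * + 0 - b * + 0 + c * + 0 + d * + 0 ≡ + 0
  im₂ = solve-∀
  im₃ : ∀ a b c d → a * + 0 + b * + 0 - c * + 0 + d * + 0 ≡ + 0
  im₃ = solve-∀

module Congruence (m : ℕ) where

  infix 4 _≈_ _≈ℍ_

  record _≈_ (a b : ℤ) : Set where
    constructor mk≈
    field m∣a-b : + m ∣ a - b

  ≈-via : ∀ {a b e} → a - b ≡ e → + m ∣ e → a ≈ b
  ≈-via a-b≡e m∣e = mk≈ (subst (+ m ∣_) (sym a-b≡e) m∣e)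

  ≈-refl : ∀ {a} → a ≈ a
  ≈-refl {a} = ≈-via (a-a≡0*m a) (∣n⇒∣m*n (+ 0) ∣-refl)
    where
    a-a≡0*m : ∀ a → a - a ≡ + 0 * + m
    a-a≡0*m = solve-∀

  ≈-sym : ∀ {a b} → a ≈ b → b ≈ a
  ≈-sym {a} {b} (mk≈ m∣a-b) = ≈-via (b-a≡-[a-b] a b) (∣m⇒∣-m m∣a-b)
    where
    b-a≡-[a-b] : ∀ a b → b - a ≡ - (a - b)
    b-a≡-[a-b] = solve-∀

  ≈-trans : ∀ {a b c} → a ≈ b → b ≈ c → a ≈ c
  ≈-trans {a} {b} {c} (mk≈ m∣a-b) (mk≈ m∣b-c) =
    ≈-via (telescope a b c) (∣m∣n⇒∣m+n m∣a-b m∣b-c)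
    where
    telescope : ∀ a b c → a - c ≡ (a - b) + (b - c)
    telescope = solve-∀

  +-cong : ∀ {a b c d} → a ≈ b → c ≈ d → a + c ≈ b + d
  +-cong {a} {b} {c} {d} (mk≈ m∣a-b) (mk≈ m∣c-d) =
    ≈-via (regroup a b c d) (∣m∣n⇒∣m+n m∣a-b m∣c-d)
    where
    regroup : ∀ a b c d → (a + c) - (b + d) ≡ (a - b) + (c - d)
    regroup = solve-∀

  neg-cong : ∀ {a b} → a ≈ b → - a ≈ - b
  neg-cong {a} {b} (mk≈ m∣a-b) = ≈-via (regroup a b) (∣m⇒∣-m m∣a-b)
    where
    regroup : ∀ a b → - a - - b ≡ - (a - b)
    regroup = solve-∀

  minus-cong : ∀ {a b c d} → a ≈ b → c ≈ d → a - c ≈ b - d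
  minus-cong a≈b c≈d = +-cong a≈b (neg-cong c≈d)

  *-cong : ∀ {a b c d} → a ≈ b → c ≈ d → a * c ≈ b * d
  *-cong {a} {b} {c} {d} (mk≈ m∣a-b) (mk≈ m∣c-d) =
    ≈-via (regroup a b c d) (∣m∣n⇒∣m+n (∣m⇒∣m*n c m∣a-b) (∣n⇒∣m*n b m∣c-d))
    where
    regroup : ∀ a b c d → a * c - b * d ≡ (a - b) * c + b * (c - d)
    regroup = solve-∀

  +k%m≈+k : ∀ k .{{_ : NonZero m}} → + (k % m) ≈ + k
  +k%m≈+k k = ≈-sym (≈-via (k-r≡q*m (+ k)) (∣n⇒∣m*n (+ (k / m)) ∣-refl))
    where
    r+q*m-r≡q*m : ∀ r q m → r + q * m - r ≡ q * m
    r+q*m-r≡q*m = solve-∀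
    k-r≡q*m : ∀ k → k - + (k %ℕ m) ≡ (k /ℕ m) * + m
    k-r≡q*m k = trans (cong (_- + (k %ℕ m)) (a≡a%ℕn+[a/ℕn]*n k m))
                      (r+q*m-r≡q*m (+ (k %ℕ m)) (k /ℕ m) (+ m))

  +[m∸k]≈-k : ∀ {k} → k ℕ.≤ m → + (m ℕ.∸ k) ≈ - + k
  +[m∸k]≈-k {k} k≤m = ≈-via (trans (x--y≡x+y (+ (m ℕ.∸ k)) (+ k)) [m∸k]+k≡m) ∣-refl
    where
    x--y≡x+y : ∀ x y → x - - y ≡ x + y
    x--y≡x+y = solve-∀
    [m∸k]+k≡m : + (m ℕ.∸ k) + + k ≡ + m
    [m∸k]+k≡m = trans (sym (pos-+ (m ℕ.∸ k) k)) (cong +_ (m∸n+n≡m k≤m))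

  ∣∧<⇒≡0 : ∀ {k} → m ℕ.∣ k → k < m → k ≡ 0
  ∣∧<⇒≡0 {ℕ.zero}  _   _   = refl
  ∣∧<⇒≡0 {suc k} m∣k k<m = ⊥-elim (ℕ.>⇒∤ k<m m∣k)

  ≤∧≈⇒≡ : ∀ {r s} → s ℕ.≤ r → r < m → + r ≈ + s → r ≡ s
  ≤∧≈⇒≡ {r} {s} s≤r r<m (mk≈ m∣r-s) = ≤-antisym (m∸n≡0⇒m≤n r∸s≡0) s≤r
    where
    m∣r∸s : m ℕ.∣ r ℕ.∸ s
    m∣r∸s = ∣⇒∣ᵤ (subst (+ m ∣_) (trans (m-n≡m⊖n r s) (⊖-≥ s≤r)) m∣r-s)
    r∸s≡0 : r ℕ.∸ s ≡ 0
    r∸s≡0 = ∣∧<⇒≡0 m∣r∸s (≤-<-trans (m∸n≤m r s) r<m)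

  residue-≈⇒≡ : ∀ {r s} → r < m → s < m → + r ≈ + s → r ≡ s
  residue-≈⇒≡ {r} {s} r<m s<m r≈s with ≤-total s r
  ... | inj₁ s≤r = ≤∧≈⇒≡ s≤r r<m r≈s
  ... | inj₂ r≤s = sym (≤∧≈⇒≡ r≤s s<m (≈-sym r≈s))

  record _≈ℍ_ (p q : ℤℍ) : Set where
    constructor mk≈ℍ
    field
      re≈  : ℤℍ.re p ≈ ℤℍ.re q
      im₁≈ : ℤℍ.im₁ p ≈ ℤℍ.im₁ q
      im₂≈ : ℤℍ.im₂ p ≈ ℤℍ.im₂ q
      im₃≈ : ℤℍ.im₃ p ≈ ℤℍ.im₃ q

  ≈ℍ-refl : ∀ {p} → p ≈ℍ p
  ≈ℍ-refl = mk≈ℍ ≈-refl ≈-refl ≈-refl ≈-refl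

  ≈ℍ-isEquivalence : IsEquivalence _≈ℍ_
  ≈ℍ-isEquivalence = record
    { refl  = ≈ℍ-refl
    ; sym   = λ (mk≈ℍ a b c d) → mk≈ℍ (≈-sym a) (≈-sym b) (≈-sym c) (≈-sym d)
    ; trans = λ (mk≈ℍ a b c d) (mk≈ℍ a′ b′ c′ d′) →
        mk≈ℍ (≈-trans a a′) (≈-trans b b′) (≈-trans c c′) (≈-trans d d′)
    }

  ≈ℍ-setoid : Setoid _ _
  ≈ℍ-setoid = record { isEquivalence = ≈ℍ-isEquivalence }

  ·ℤ-cong : ∀ {p p′ q q′} → p ≈ℍ p′ → q ≈ℍ q′ → p ·ℤ q ≈ℍ p′ ·ℤ q′
  ·ℤ-cong {quatℤ _ _ _ _} {quatℤ _ _ _ _} {quatℤ _ _ _ _} {quatℤ _ _ _ _}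
    (mk≈ℍ a1 a2 a3 a4) (mk≈ℍ b1 b2 b3 b4) = mk≈ℍ
    (minus-cong (minus-cong (minus-cong (*-cong a1 b1) (*-cong a2 b2)) (*-cong a3 b3)) (*-cong a4 b4))
    (minus-cong (+-cong (+-cong (*-cong a1 b2) (*-cong a2 b1)) (*-cong a3 b4)) (*-cong a4 b3))
    (+-cong (+-cong (minus-cong (*-cong a1 b3) (*-cong a2 b4)) (*-cong a3 b1)) (*-cong a4 b2))
    (+-cong (minus-cong (+-cong (*-cong a1 b4) (*-cong a2 b3)) (*-cong a3 b2)) (*-cong a4 b1))

module Reduction (n : ℕ) where
  open Zmod n
  open Quat n
  open Congruence M

  ⟦_⟧ : ℤ₂^ n → ℤ
  ⟦ a ⟧ = + toℕ a

  ⟦_⟧ℍ : ℍ n → ℤℍ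
  ⟦ quat a b c d ⟧ℍ = quatℤ ⟦ a ⟧ ⟦ b ⟧ ⟦ c ⟧ ⟦ d ⟧

  ⟦mod⟧ : ∀ k → ⟦ k mod M ⟧ ≈ + k
  ⟦mod⟧ k rewrite toℕ-fromℕ< (m%n<n k M) = +k%m≈+k k

  ⟦⊕⟧ : ∀ {a b A B} → ⟦ a ⟧ ≈ A → ⟦ b ⟧ ≈ B → ⟦ a ⊕ b ⟧ ≈ A + B
  ⟦⊕⟧ {a} {b} {A} {B} a≈A b≈B =
    ≈-trans (⟦mod⟧ (toℕ a ℕ.+ toℕ b))
      (subst (_≈ A + B) (sym (pos-+ (toℕ a) (toℕ b))) (+-cong a≈A b≈B))

  ⟦⊗⟧ : ∀ {a b A B} → ⟦ a ⟧ ≈ A → ⟦ b ⟧ ≈ B → ⟦ a ⊗ b ⟧ ≈ A * B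
  ⟦⊗⟧ {a} {b} {A} {B} a≈A b≈B =
    ≈-trans (⟦mod⟧ (toℕ a ℕ.* toℕ b))
      (subst (_≈ A * B) (sym (pos-* (toℕ a) (toℕ b))) (*-cong a≈A b≈B))

  ⟦⊖⟧ : ∀ {a A} → ⟦ a ⟧ ≈ A → ⟦ ⊖ a ⟧ ≈ - A
  ⟦⊖⟧ {a} a≈A =
    ≈-trans (⟦mod⟧ (M ℕ.∸ toℕ a))
      (≈-trans (+[m∸k]≈-k (ℕ.<⇒≤ (toℕ<n a))) (neg-cong a≈A))

  ⟦⊝⟧ : ∀ {a b A B} → ⟦ a ⟧ ≈ A → ⟦ b ⟧ ≈ B → ⟦ a ⊝ b ⟧ ≈ A - B
  ⟦⊝⟧ a≈A b≈B = ⟦⊕⟧ a≈A (⟦⊖⟧ b≈B)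

  ⟦·⟧ℍ : ∀ x y → ⟦ x · y ⟧ℍ ≈ℍ ⟦ x ⟧ℍ ·ℤ ⟦ y ⟧ℍ
  ⟦·⟧ℍ (quat a1 a2 a3 a4) (quat b1 b2 b3 b4) = mk≈ℍ
    (⟦⊝⟧ (⟦⊝⟧ (⟦⊝⟧ (a1 ⊗′ b1) (a2 ⊗′ b2)) (a3 ⊗′ b3)) (a4 ⊗′ b4))
    (⟦⊝⟧ (⟦⊕⟧ (⟦⊕⟧ (a1 ⊗′ b2) (a2 ⊗′ b1)) (a3 ⊗′ b4)) (a4 ⊗′ b3))
    (⟦⊕⟧ (⟦⊕⟧ (⟦⊝⟧ (a1 ⊗′ b3) (a2 ⊗′ b4)) (a3 ⊗′ b1)) (a4 ⊗′ b2))
    (⟦⊕⟧ (⟦⊝⟧ (⟦⊕⟧ (a1 ⊗′ b4) (a2 ⊗′ b3)) (a3 ⊗′ b2)) (a4 ⊗′ b1))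
    where
    _⊗′_ : ∀ a b → ⟦ a ⊗ b ⟧ ≈ ⟦ a ⟧ * ⟦ b ⟧
    a ⊗′ b = ⟦⊗⟧ {a} {b} ≈-refl ≈-refl

  ⟦1ℍ⟧ : ⟦ 1ℍ ⟧ℍ ≈ℍ 1ℤℍ
  ⟦1ℍ⟧ = mk≈ℍ (⟦mod⟧ 1) (⟦mod⟧ 0) (⟦mod⟧ 0) (⟦mod⟧ 0)

  ⟦0ℍ⟧ : ⟦ 0ℍ ⟧ℍ ≈ℍ 0ℤℍ
  ⟦0ℍ⟧ = mk≈ℍ (⟦mod⟧ 0) (⟦mod⟧ 0) (⟦mod⟧ 0) (⟦mod⟧ 0)

  ⟦⟧-injective : ∀ {a b} → ⟦ a ⟧ ≈ ⟦ b ⟧ → a ≡ b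
  ⟦⟧-injective {a} {b} a≈b = toℕ-injective (residue-≈⇒≡ (toℕ<n a) (toℕ<n b) a≈b)

  ⟦⟧ℍ-injective : ∀ {x y} → ⟦ x ⟧ℍ ≈ℍ ⟦ y ⟧ℍ → x ≡ y
  ⟦⟧ℍ-injective {quat _ _ _ _} {quat _ _ _ _} (mk≈ℍ a b c d)
    rewrite ⟦⟧-injective a | ⟦⟧-injective b | ⟦⟧-injective c | ⟦⟧-injective d = refl

  open SetoidReasoning ≈ℍ-setoid

  ·-assoc : Associative _≡_ _·_
  ·-assoc x y z = ⟦⟧ℍ-injective (begin
    ⟦ (x · y) · z ⟧ℍ              ≈⟨ ⟦·⟧ℍ (x · y) z ⟩
    ⟦ x · y ⟧ℍ ·ℤ ⟦ z ⟧ℍ          ≈⟨ ·ℤ-cong (⟦·⟧ℍ x y) (≈ℍ-refl {⟦ z ⟧ℍ}) ⟩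
    (⟦ x ⟧ℍ ·ℤ ⟦ y ⟧ℍ) ·ℤ ⟦ z ⟧ℍ  ≡⟨ ·ℤ-assoc ⟦ x ⟧ℍ ⟦ y ⟧ℍ ⟦ z ⟧ℍ ⟩
    ⟦ x ⟧ℍ ·ℤ (⟦ y ⟧ℍ ·ℤ ⟦ z ⟧ℍ)  ≈⟨ ·ℤ-cong (≈ℍ-refl {⟦ x ⟧ℍ}) (⟦·⟧ℍ y z) ⟨
    ⟦ x ⟧ℍ ·ℤ ⟦ y · z ⟧ℍ          ≈⟨ ⟦·⟧ℍ x (y · z) ⟨
    ⟦ x · (y · z) ⟧ℍ              ∎)

  ·-identityˡ : LeftIdentity _≡_ 1ℍ _·_
  ·-identityˡ x = ⟦⟧ℍ-injective (begin
    ⟦ 1ℍ · x ⟧ℍ             ≈⟨ ⟦·⟧ℍ 1ℍ x ⟩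
    ⟦ 1ℍ ⟧ℍ ·ℤ ⟦ x ⟧ℍ       ≈⟨ ·ℤ-cong ⟦1ℍ⟧ (≈ℍ-refl {⟦ x ⟧ℍ}) ⟩
    1ℤℍ ·ℤ ⟦ x ⟧ℍ           ≡⟨ ·ℤ-identityˡ ⟦ x ⟧ℍ ⟩
    ⟦ x ⟧ℍ                  ∎)

  ·-zeroʳ : RightZero _≡_ 0ℍ _·_
  ·-zeroʳ x = ⟦⟧ℍ-injective (begin
    ⟦ x · 0ℍ ⟧ℍ             ≈⟨ ⟦·⟧ℍ x 0ℍ ⟩
    ⟦ x ⟧ℍ ·ℤ ⟦ 0ℍ ⟧ℍ       ≈⟨ ·ℤ-cong (≈ℍ-refl {⟦ x ⟧ℍ}) ⟦0ℍ⟧ ⟩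
    ⟦ x ⟧ℍ ·ℤ 0ℤℍ           ≡⟨ ·ℤ-zeroʳ ⟦ x ⟧ℍ ⟩
    0ℤℍ                     ≈⟨ ⟦0ℍ⟧ ⟨
    ⟦ 0ℍ ⟧ℍ                 ∎)

proposition4p1 : (n : ℕ) → n ≥ 1 → (u : ℍ n) → Quat.In𝒰 n u →
    (v : ℍ n) → Quat.IsVertex n v → u ≢ v → Quat.Adjacent n u v
proposition4p1 n _ u ((y , _ , y·u≡1) , _) v (v≢0 , _) u≢v =
  u≢v , inj₁ (λ u·v≡0 → v≢0 (u·v≡0⇒v≡0 y·u≡1 u·v≡0))
  where
  open Quat n
  open Reduction n
  u·v≡0⇒v≡0 : y · u ≡ 1ℍ → u · v ≡ 0ℍ → v ≡ 0ℍ
  u·v≡0⇒v≡0 = y∙u≡ε⇒u∙w≡0⇒w≡0 {_∙_ = _·_} ·-assoc ·-identityˡ ·-zeroʳ {y} {u} {v}
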